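{- Let $\alpha=(a_1,\dots,a_w)$ be a sequence of reals and suppose its QN-list $\mathbb{L}_\alpha$ is given. The LIS enumeration algorithm described below outputs all longest increasing subsequences of $\alpha$ in time $O(\mathrm{OUTPUT})$, where $\mathrm{OUTPUT}$ is the total size (sum of lengths) of all longest increasing subsequences of $\alpha$.
   Context: Items are identified with their positions. An increasing subsequence is a subsequence $a_{i_1},\dots,a_{i_k}$, $i_1<\dots<i_k$, with $a_{i_1}\le\dots\le a_{i_k}$; a longest increasing subsequence (LIS) is one of maximum length. $a_j$ is compatible with $a_i$ if $j<i$ and $a_j\le a_i$. The rising length $RL(a_i)$ is the maximum length of an increasing subsequence ending with $a_i$; $a_j$ is a predecessor of $a_i$ if $a_j$ is compatible with $a_i$ and $RL(a_j)=RL(a_i)-1$. Neighbors of $a_i$: left/right neighbor $ln(a_i)$/$rn(a_i)$ = nearest item before/after $a_i$ with the same rising length; up/down neighbor $un(a_i)$/$dn(a_i)$ = nearest item before $a_i$ with rising length $RL(a_i)-1$ / $RL(a_i)+1$. The horizontal list $\mathbb{L}_\alpha^t$ lists the items of rising length $t$ in increasing order of position; the QN-list $\mathbb{L}_\alpha$ consists of all $m$ nonempty horizontal lists plus all neighbor links. Enumeration algorithm: a depth-first search using a stack; every item of the last list $\mathbb{L}_\alpha^m$ is used as a starting bottom element; whenever the top of the stack is $a\in\mathbb{L}_\alpha^t$ with $t>1$, each predecessor of $a$ is pushed in turn, the predecessors being obtained by scanning $\mathbb{L}_\alpha^{t-1}$ from $un(a)$ leftwards (via left-neighbor links) until an item not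 compatible with $a$ is met; when the stack top lies in $\mathbb{L}_\alpha^1$ the stack content (an LIS) is output, and the search backtracks. -}

module Defs where

open import Level using (0ℓ)
open import Data.Nat as ℕ using (ℕ; zero; suc; _+_; _∸_)
open import Data.Fin as Fin using (Fin)
open import Data.Vec using (Vec; lookup)
open import Data.List using (List; []; _∷_; length; last)
open import Data.List.Relation.Unary.Linked using (Linked)
open import Data.List.Membership.Propositional using (_∈_)
open import Data.Maybe using (Maybe; just; nothing)
open import Data.Product using (Σ; ∃; _×_; _,_)
open import Data.Empty using (⊥)
open import Relation.Nullary using (¬_; yes; no)
open import Relation.Binary.Bundles using (DecTotalOrder)
open import Relation.Binary.PropositionalEquality using (_≡_)
open import Function.Bundles using (_⇔_)

-- Everything is parameterised by the (decidable, total) order on the values.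
-- The paper's reals are one instance; only comparisons a_j ≤ a_i are used.
module LIS (O : DecTotalOrder 0ℓ 0ℓ 0ℓ) where
  open DecTotalOrder O renaming (Carrier to A; _≤_ to _≼_; _≤?_ to _≼?_)

  module _ {w : ℕ} (α : Vec A w) where

    IsIncSubseq : List (Fin w) → Set
    IsIncSubseq s = Linked Fin._<_ s × Linked (λ i j → lookup α i ≼ lookup α j) s

    IsLIS : List (Fin w) → Set
    IsLIS s = IsIncSubseq s × (∀ s′ → IsIncSubseq s′ → length s′ ℕ.≤ length s)

    IsRL : Fin w → ℕ → Set
    IsRL i r = (∃ λ s → IsIncSubseq s × last s ≡ just i × length s ≡ r)
             × (∀ s → IsIncSubseq s → last s ≡ just i → length s ℕ.≤ r)

  NearestBefore : ∀ {w} → (Fin w → Set) → Fin w → Maybe (Fin w) → Set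
  NearestBefore P i (just j) = j Fin.< i × P j × (∀ k → j Fin.< k → k Fin.< i → ¬ P k)
  NearestBefore P i nothing  = ∀ k → k Fin.< i → ¬ P k

  NearestAfter : ∀ {w} → (Fin w → Set) → Fin w → Maybe (Fin w) → Set
  NearestAfter P i (just j) = i Fin.< j × P j × (∀ k → i Fin.< k → k Fin.< j → ¬ P k)
  NearestAfter P i nothing  = ∀ k → i Fin.< k → ¬ P k

  -- The QN-list data structure: number m of nonempty horizontal lists,
  -- the rising length stored with each item, the horizontal lists
  -- (horiz t = 𝕃^t), and the four neighbour links.
  record QNList (w : ℕ) : Set where
    field
      m     : ℕ
      level : Fin w → ℕ
      horiz : ℕ → List (Fin w)
      ln rn un dn : Fin w → Maybe (Fin w)

  record IsQNList {w : ℕ} (α : Vec A w) (q : QNList w) : Set where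
    open QNList q
    field
      level-RL : ∀ i → IsRL α i (level i)
      m-nonempty : ∀ t → 1 ℕ.≤ t → t ℕ.≤ m → ∃ λ i → level i ≡ t
      m-max      : ∀ i → level i ℕ.≤ m
      horiz-sorted : ∀ t → Linked Fin._<_ (horiz t)
      horiz-mem    : ∀ t i → (i ∈ horiz t) ⇔ (level i ≡ t)
      ln-spec : ∀ i → NearestBefore (λ k → level k ≡ level i) i (ln i)
      rn-spec : ∀ i → NearestAfter  (λ k → level k ≡ level i) i (rn i)
      un-spec : ∀ i → NearestBefore (λ k → suc (level k) ≡ level i) i (un i)
      dn-spec : ∀ i → NearestBefore (λ k → level k ≡ suc (level i)) i (dn i)

  -- Cost model: each stack push / link traversal / comparison costs 1,
  -- writing an output costs its length.
  module Algorithm {w : ℕ} (α : Vec A w) (q : QNList w) where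
    open QNList q

    Res : Set
    Res = List (List (Fin w)) × ℕ

    _⊕_ : Res → Res → Res
    (o₁ , c₁) ⊕ (o₂ , c₂) = (o₁ Data.List.++ o₂) , (c₁ + c₂)

    tick : Res → Res
    tick (o , c) = o , suc c

    mutual
      -- stack has top element a (head of the list); a lies in 𝕃^(suc t)
      dfs : (t : ℕ) → Fin w → List (Fin w) → Res
      dfs zero    a stack = (stack ∷ []) , length stack
      dfs (suc t) a stack = tick (scan t a w (un a) stack)

      -- scan 𝕃^(suc t) leftwards from the given item, pushing each item
      -- compatible with a; stop at the first incompatible item.
      -- (fuel bounds the scan length; w suffices since ln decreases positions)
      scan : (t : ℕ) → Fin w → ℕ → Maybe (Fin w) → List (Fin w) → Res
      scan t a zero     _        stack = [] , 0
      scan t a (suc f)  nothing  stack = [] , 1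
      scan t a (suc f)  (just b) stack with lookup α b ≼? lookup α a
      ... | yes _ = tick (dfs t b (b ∷ stack) ⊕ scan t a f (ln b) stack)
      ... | no  _ = [] , 1

    starts : List (Fin w) → Res
    starts []       = [] , 1
    starts (a ∷ as) = tick (dfs (m ∸ 1) a (a ∷ [])) ⊕ starts as

    run : Res
    run = starts (horiz m)

    output : List (List (Fin w))
    output = Data.Product.proj₁ run

    steps : ℕ
    steps = Data.Product.proj₂ run

module Submission where

-- A chain
-- of length t + 1 ending in a is an increasing subsequence p ∷ʳ a with |p| = t.
-- (1) Rising lengths: compatible items have strictly increasing RL, hence the
--     items of one horizontal list decrease in value; so the leftward scan of
--     𝕃^t started at un(a) meets every predecessor of a before it meets the
--     first item incompatible with a, and an item of RL t + 1 ends some chain.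
-- (2) Correctness, by induction along the mutually recursive dfs / scan:
--     dfs t a (a ∷ rest) outputs exactly the lists p ++ a ∷ rest for the chains
--     p ∷ʳ a of length t + 1, each once (two branches differ at depth t).
-- (3) Cost, by the same induction: a dfs call with k stack items costs at most
--     k + 4t per output, every scan step being paid by the call it starts.
-- (4) The LISs are the increasing subsequences of length m, i.e. the chains
--     ending in 𝕃^m.  So the algorithm outputs every LIS exactly once and takes
--     at most 4m steps per output: steps ≤ 4 · OUTPUT.

open import Defs
open import Level using (0ℓ)
open import Data.Nat using (ℕ; suc; _≤_; _*_)
open import Data.Fin using (Fin)
open import Data.Vec using (Vec)
open import Data.List using (List; map; length)
open import Data.Nat.ListAction using (sum)
open import Data.List.Relation.Unary.Unique.Propositional using (Unique)
open import Data.List.Membership.Propositional using (_∈_)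
open import Data.Product using (Σ; _×_)
open import Relation.Binary.Bundles using (DecTotalOrder)
open import Function.Bundles using (_⇔_)

open import Data.Nat using (zero; _+_; _∸_; _<_; z≤n; s≤s)
import Data.Nat.Properties as ℕP
open import Data.Nat.Tactic.RingSolver using (solve-∀)
import Data.Fin as F
import Data.Fin.Properties as FP
open import Data.Fin using (toℕ)
open import Data.Vec using (lookup)
open import Data.List using ([]; _∷_; _++_; _∷ʳ_; last; initLast; _∷ʳ′_)
import Data.List.Properties as LP
open import Data.List.Relation.Unary.Linked using (Linked; [-]; _∷_)
open import Data.List.Relation.Unary.Linked.Properties using (Linked⇒AllPairs; ++⁺)
import Data.Maybe.Relation.Binary.Connected as Connected
open import Data.List.Relation.Unary.Any using (here; there; index; _─_)
import Data.List.Relation.Unary.All as All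
open import Data.List.Relation.Unary.AllPairs using (AllPairs; []; _∷_)
import Data.List.Relation.Unary.Unique.Propositional.Properties as UniqueP
open import Data.List.Membership.Propositional.Properties using (∈-++⁻; ∈-++⁺ˡ; ∈-++⁺ʳ)
open import Data.Maybe using (Maybe; just; nothing)
open import Data.Product using (_,_; proj₁; proj₂; ∃; ∃₂)
open import Data.Sum using (inj₁; inj₂)
open import Data.Empty using (⊥-elim)
open import Relation.Nullary using (¬_; yes; no)
open import Relation.Binary.Definitions using (tri<; tri≈; tri>)
open import Relation.Binary.PropositionalEquality
open import Function.Bundles using (mk⇔; Equivalence)

module _ {A : Set} where

  last-∷ʳ : ∀ (xs : List A) x → last (xs ∷ʳ x) ≡ just x
  last-∷ʳ []           x = refl
  last-∷ʳ (y ∷ [])     x = refl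
  last-∷ʳ (y ∷ z ∷ xs) x = last-∷ʳ (z ∷ xs) x

  length-∷ʳ : ∀ (xs : List A) x → length (xs ∷ʳ x) ≡ suc (length xs)
  length-∷ʳ xs x = trans (LP.length-++ xs) (ℕP.+-comm (length xs) 1)

  ∷ʳ-of-last : ∀ (xs : List A) {a} → last xs ≡ just a → ∃ λ p → xs ≡ p ∷ʳ a
  ∷ʳ-of-last []           ()
  ∷ʳ-of-last (x ∷ [])     refl = [] , refl
  ∷ʳ-of-last (x ∷ y ∷ xs) e    with ∷ʳ-of-last (y ∷ xs) e
  ... | p , eq = x ∷ p , cong (x ∷_) eq

  ++-∷-middle : ∀ (xs ys : List A) {x y l l′} → length xs ≡ length ys →
                xs ++ x ∷ l ≡ ys ++ y ∷ l′ → x ≡ y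
  ++-∷-middle []       []       _   e = LP.∷-injectiveˡ e
  ++-∷-middle (_ ∷ xs) (_ ∷ ys) len e =
    ++-∷-middle xs ys (ℕP.suc-injective len) (LP.∷-injectiveʳ e)

  module _ {R : A → A → Set} where

    linked-∷ʳ⁺ : ∀ {xs x y} → Linked R xs → last xs ≡ just x → R x y → Linked R (xs ∷ʳ y)
    linked-∷ʳ⁺ {y = y} l e r =
      ++⁺ l (subst (λ z → Connected.Connected R z (just y)) (sym e) (Connected.just r)) [-]

    linked-∷ʳ⁻ : ∀ xs {x y} → Linked R (xs ∷ʳ x ∷ʳ y) → Linked R (xs ∷ʳ x) × R x y
    linked-∷ʳ⁻ []           (r ∷ [-]) = [-] , r
    linked-∷ʳ⁻ (z ∷ [])     (r ∷ l)   with linked-∷ʳ⁻ [] l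
    ... | l′ , r′ = r ∷ l′ , r′
    linked-∷ʳ⁻ (z ∷ v ∷ xs) (r ∷ l)   with linked-∷ʳ⁻ (v ∷ xs) l
    ... | l′ , r′ = r ∷ l′ , r′

  ∈⇒nonempty : ∀ {x : A} {xs} → x ∈ xs → 1 ≤ length xs
  ∈⇒nonempty (here _)  = s≤s z≤n
  ∈⇒nonempty (there _) = s≤s z≤n

  unique-⊆-length : ∀ {xs ys : List A} → Unique xs → (∀ {x} → x ∈ xs → x ∈ ys) →
                    length xs ≤ length ys
  unique-⊆-length {[]}     _            _   = z≤n
  unique-⊆-length {x ∷ xs} {ys} (x∉xs ∷ u) sub = begin
      suc (length xs)           ≤⟨ s≤s (unique-⊆-length u (λ y∈xs → ∈-─ x∈ys (sub (there y∈xs))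
                                                              (≢-sym (All.lookup x∉xs y∈xs)))) ⟩
      suc (length (ys ─ x∈ys))  ≡⟨ sym (LP.length-removeAt′ ys (index x∈ys)) ⟩
      length ys                 ∎
    where
      open ℕP.≤-Reasoning
      x∈ys : x ∈ ys
      x∈ys = sub (here refl)
      ∈-─ : ∀ {x y : A} {zs} (p : x ∈ zs) → y ∈ zs → y ≢ x → y ∈ (zs ─ p)
      ∈-─ (here refl) (here refl) y≢x = ⊥-elim (y≢x refl)
      ∈-─ (here refl) (there q)   _   = q
      ∈-─ (there p)   (here refl) _   = here refl
      ∈-─ (there p)   (there q)   y≢x = there (∈-─ p q y≢x)

  sum-length-const : ∀ (L : List (List A)) k → (∀ s → s ∈ L → length s ≡ k) →
                     sum (map length L) ≡ length L * k
  sum-length-const []      k h = refl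
  sum-length-const (s ∷ L) k h =
    cong₂ _+_ (h s (here refl)) (sum-length-const L k (λ s′ i → h s′ (there i)))

absorb : ∀ {X K N} → 1 ≤ N → X ≤ suc (K * N) → X ≤ suc K * N
absorb {K = K} {N} 1≤N X≤ = ℕP.≤-trans X≤ (ℕP.+-monoˡ-≤ (K * N) 1≤N)

combine-cost : ∀ {c₁ c₂ o₁ o₂ B} → 1 ≤ o₁ → c₁ ≤ B * o₁ → c₂ ≤ suc (suc B * o₂) →
               suc (c₁ + c₂) ≤ suc (suc B * (o₁ + o₂))
combine-cost {c₁} {c₂} {o₁} {o₂} {B} 1≤o₁ h₁ h₂ = s≤s (begin
    c₁ + c₂                      ≤⟨ ℕP.+-mono-≤ h₁ h₂ ⟩
    B * o₁ + suc (suc B * o₂)    ≡⟨ ℕP.+-suc (B * o₁) _ ⟩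
    suc (B * o₁ + suc B * o₂)    ≤⟨ ℕP.+-monoˡ-≤ _ 1≤o₁ ⟩
    o₁ + (B * o₁ + suc B * o₂)   ≡⟨ distribute B o₁ o₂ ⟩
    suc B * (o₁ + o₂)            ∎)
  where
    open ℕP.≤-Reasoning
    distribute : ∀ B o₁ o₂ → o₁ + (B * o₁ + suc B * o₂) ≡ suc B * (o₁ + o₂)
    distribute = solve-∀

suc-∸1 : ∀ {k} → 1 ≤ k → k ≡ suc (k ∸ 1)
suc-∸1 (s≤s _) = refl

module Correctness (O : DecTotalOrder 0ℓ 0ℓ 0ℓ) {w : ℕ} (α : Vec (DecTotalOrder.Carrier O) w)
                   (q : LIS.QNList O w) (Q : LIS.IsQNList O α q) where
  open DecTotalOrder O using () renaming (_≤_ to _≼_; _≤?_ to _≼?_; trans to ≼-trans; total to ≼-total)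
  open LIS O
  open LIS.Algorithm O α q
  open QNList q
  open IsQNList Q

  Inc : List (Fin w) → Set
  Inc = IsIncSubseq α

  _≼ₚ_ : Fin w → Fin w → Set
  j ≼ₚ i = lookup α j ≼ lookup α i

  Compatible : Fin w → Fin w → Set
  Compatible j i = j F.< i × j ≼ₚ i

  inc-∷ʳ⁺ : ∀ {s c a} → Inc s → last s ≡ just c → Compatible c a → Inc (s ∷ʳ a)
  inc-∷ʳ⁺ (l< , l≼) e (c<a , c≼a) = linked-∷ʳ⁺ l< e c<a , linked-∷ʳ⁺ l≼ e c≼a

  inc-∷ʳ⁻ : ∀ p {c a} → Inc (p ∷ʳ c ∷ʳ a) → Inc (p ∷ʳ c) × Compatible c a
  inc-∷ʳ⁻ p (l< , l≼) with linked-∷ʳ⁻ p l< | linked-∷ʳ⁻ p l≼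
  ... | i< , c<a | i≼ , c≼a = (i< , i≼) , (c<a , c≼a)

  Chain : ℕ → Fin w → List (Fin w) → Set
  Chain t a p = length p ≡ t × Inc (p ∷ʳ a)

  length≤level : ∀ p {a} → Inc (p ∷ʳ a) → suc (length p) ≤ level a
  length≤level p {a} inc =
    subst (_≤ level a) (length-∷ʳ p a) (proj₂ (level-RL a) (p ∷ʳ a) inc (last-∷ʳ p a))

  chain-exists : ∀ {t a} → level a ≡ suc t → ∃ (Chain t a)
  chain-exists {t} {a} la with proj₁ (level-RL a)
  ... | s , inc , e , len with ∷ʳ-of-last s e
  ...   | p , refl = p , ℕP.suc-injective (trans (sym (length-∷ʳ p a)) (trans len la)) , inc

  level-positive : ∀ i → 1 ≤ level i
  level-positive i with proj₁ (level-RL i)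
  ... | []    , _ , () , _
  ... | _ ∷ _ , _ , _  , len = subst (1 ≤_) len (s≤s z≤n)

  -- An item compatible with a_i extends an increasing subsequence to a_i:
  -- RL strictly increases along compatibility.
  compatible⇒level< : ∀ {j i} → Compatible j i → level j < level i
  compatible⇒level< {j} {i} ji with proj₁ (level-RL j)
  ... | s , inc , e , len = subst (λ r → suc r ≤ level i) len (length≤level s (inc-∷ʳ⁺ inc e ji))

  -- Items of equal RL decrease in value, so an item incompatible with a makes
  -- every earlier item of its horizontal list incompatible with a: this is why
  -- the scan may stop at the first incompatible item.
  scan-stop : ∀ {a b c} → c F.< b → level c ≡ level b → ¬ (b ≼ₚ a) → ¬ (c ≼ₚ a)
  scan-stop {a} {b} {c} c<b lc≡lb b⋠a c≼a with ≼-total (lookup α b) (lookup α c)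
  ... | inj₁ b≼c = b⋠a (≼-trans b≼c c≼a)
  ... | inj₂ c≼b = ℕP.<-irrefl lc≡lb (compatible⇒level< (c<b , c≼b))

  chain-predecessor : ∀ {t a c} p → Chain (suc t) a (p ∷ʳ c) → level a ≡ suc (suc t) →
                      Chain t c p × Compatible c a × level c ≡ suc t
  chain-predecessor {t} {a} {c} p (len , inc) la with inc-∷ʳ⁻ p inc
  ... | inc′ , ca = (|p| , inc′) , ca , ℕP.≤-antisym
      (ℕP.≤-pred (subst (suc (level c) ≤_) la (compatible⇒level< ca)))
      (subst (_≤ level c) (cong suc |p|) (length≤level p inc′))
    where
      |p| : length p ≡ t
      |p| = ℕP.suc-injective (trans (sym (length-∷ʳ p c)) len)

  increasing≤m : ∀ s → Inc s → length s ≤ m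
  increasing≤m s inc with initLast s
  ... | []      = z≤n
  ... | p ∷ʳ′ a = subst (_≤ m) (sym (length-∷ʳ p a)) (ℕP.≤-trans (length≤level p inc) (m-max a))

  Below : Fin w → Maybe (Fin w) → Set
  Below X mb = ∀ b → mb ≡ just b → b F.< X

  nearest-just : ∀ {P : Fin w → Set} {i mb j} → NearestBefore P i mb → mb ≡ just j → j F.< i × P j
  nearest-just {mb = just j} (j<i , pj , _) refl = j<i , pj

  nearest-below : ∀ {P : Fin w → Set} {i mb} → NearestBefore P i mb → Below i mb
  nearest-below nb b e = proj₁ (nearest-just nb e)

  nearest-map : ∀ {P P′ : Fin w → Set} {i} mb → (∀ k → P k → P′ k) → (∀ k → P′ k → P k) →
                NearestBefore P i mb → NearestBefore P′ i mb
  nearest-map (just j) f g (j<i , pj , none) = j<i , f j pj , λ k j<k k<i p′k → none k j<k k<i (g k p′k)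
  nearest-map nothing  f g none              = λ k k<i p′k → none k k<i (g k p′k)

  up-nearest : ∀ {t a} → level a ≡ suc (suc t) → NearestBefore (λ k → level k ≡ suc t) a (un a)
  up-nearest {a = a} la = nearest-map (un a) (λ k e → ℕP.suc-injective (trans e la))
                                            (λ k e → trans (cong suc e) (sym la)) (un-spec a)

  left-nearest : ∀ {t b} → level b ≡ suc t → NearestBefore (λ k → level k ≡ suc t) b (ln b)
  left-nearest {b = b} lb = subst (λ r → NearestBefore (λ k → level k ≡ r) b (ln b)) lb (ln-spec b)

  out : Res → List (List (Fin w))
  out = proj₁

  cost : Res → ℕ
  cost = proj₂

  DfsOut : ℕ → Fin w → List (Fin w) → List (Fin w) → Set
  DfsOut t a rest s = ∃ λ p → Chain t a p × s ≡ p ++ a ∷ rest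

  ScanOut : ℕ → Fin w → Fin w → List (Fin w) → List (Fin w) → Set
  ScanOut t a X rest s = ∃₂ λ c p → c F.< X × c ≼ₚ a × Chain t c p × s ≡ p ++ c ∷ a ∷ rest

  mutual
    dfs-sound : ∀ t a rest s → s ∈ out (dfs t a (a ∷ rest)) → DfsOut t a rest s
    dfs-sound zero    a rest s (here e) = [] , (refl , [-] , [-]) , e
    dfs-sound (suc t) a rest s m
      with scan-sound t a w (un a) rest a s (nearest-below (un-spec a)) m
    ... | c , p , c<a , c≼a , (len , inc) , e =
      p ∷ʳ c , (trans (length-∷ʳ p c) (cong suc len) , inc-∷ʳ⁺ inc (last-∷ʳ p c) (c<a , c≼a)) ,
      trans e (sym (LP.∷ʳ-++ p c (a ∷ rest)))

    scan-sound : ∀ t a f mb rest X s → Below X mb → s ∈ out (scan t a f mb (a ∷ rest)) →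
                 ScanOut t a X rest s
    scan-sound t a zero    _        rest X s below ()
    scan-sound t a (suc f) nothing  rest X s below ()
    scan-sound t a (suc f) (just b) rest X s below m with lookup α b ≼? lookup α a
    scan-sound t a (suc f) (just b) rest X s below () | no _
    ... | yes b≼a with ∈-++⁻ (out (dfs t b (b ∷ a ∷ rest))) m
    ...   | inj₁ m₁ with dfs-sound t b (a ∷ rest) s m₁
    ...     | p , ch , e = b , p , below b refl , b≼a , ch , e
    scan-sound t a (suc f) (just b) rest X s below m | yes b≼a | inj₂ m₂
      with scan-sound t a f (ln b) rest b s (nearest-below (ln-spec b)) m₂
    ... | c , p , c<b , c≼a , ch , e = c , p , FP.<-trans c<b (below b refl) , c≼a , ch , e

  -- Every chain through a predecessor c of a lying before X is reached by the
  -- scan: the scan passes all items of 𝕃^(t+1) between c and X, and none of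
  -- them stops it (scan-stop).  The fuel f bounds the number of scan steps.
  scan-complete : ∀ t a f mb rest X c s → NearestBefore (λ k → level k ≡ suc t) X mb →
                  toℕ X ≤ f → level c ≡ suc t → c F.< X → c ≼ₚ a →
                  s ∈ out (dfs t c (c ∷ a ∷ rest)) → s ∈ out (scan t a f mb (a ∷ rest))
  scan-complete t a f nothing rest X c s none _ lc c<X _ _ = ⊥-elim (none c c<X lc)
  scan-complete t a zero (just b) rest X c s (b<X , _) X≤0 _ _ _ _
    with () ← ℕP.≤-trans b<X X≤0
  scan-complete t a (suc f) (just b) rest X c s (b<X , lb , nearest) X≤f lc c<X c≼a m
    with lookup α b ≼? lookup α a | FP.<-cmp c b
  ... | _      | tri> _ _ b<c    = ⊥-elim (nearest c b<c c<X lc)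
  ... | yes _  | tri≈ _ refl _   = ∈-++⁺ˡ m
  ... | yes _  | tri< c<b _ _    =
    ∈-++⁺ʳ (out (dfs t b (b ∷ a ∷ rest)))
      (scan-complete t a f (ln b) rest b c s (left-nearest lb) (ℕP.≤-pred (ℕP.≤-trans b<X X≤f))
                     lc c<b c≼a m)
  ... | no b⋠a | tri≈ _ refl _   = ⊥-elim (b⋠a c≼a)
  ... | no b⋠a | tri< c<b _ _    = ⊥-elim (scan-stop c<b (trans lc (sym lb)) b⋠a c≼a)

  -- Completeness: a dfs call from an item a of RL t + 1 outputs every chain
  -- ending at a; the chain's second-to-last item is found by the scan from un(a).
  dfs-complete : ∀ t a rest p → level a ≡ suc t → Chain t a p → p ++ a ∷ rest ∈ out (dfs t a (a ∷ rest))
  dfs-complete zero    a rest []      _  _        = here refl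
  dfs-complete zero    a rest (_ ∷ _) _  (() , _)
  dfs-complete (suc t) a rest p′      la ch with initLast p′
  dfs-complete (suc t) a rest .[] la (() , _) | []
  ... | p ∷ʳ′ c with chain-predecessor p ch la
  ...   | chain-c , (c<a , c≼a) , lc =
    subst (_∈ out (scan t a w (un a) (a ∷ rest))) (sym (LP.∷ʳ-++ p c (a ∷ rest)))
      (scan-complete t a w (un a) rest a c _ (up-nearest la) (ℕP.<⇒≤ (FP.toℕ<n a)) lc c<a c≼a
                     (dfs-complete t c (a ∷ rest) p lc chain-c))

  -- Since every item ends a chain, no dfs call returns empty-handed; this is
  -- what makes its cost payable by its outputs.
  dfs-nonempty : ∀ t a rest → level a ≡ suc t → 1 ≤ length (out (dfs t a (a ∷ rest)))
  dfs-nonempty t a rest la with chain-exists la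
  ... | p , ch = ∈⇒nonempty (dfs-complete t a rest p la ch)

  mutual
    dfs-unique : ∀ t a rest → Unique (out (dfs t a (a ∷ rest)))
    dfs-unique zero    a rest = All.[] ∷ []
    dfs-unique (suc t) a rest = scan-unique t a w (un a) rest a (nearest-below (un-spec a))

    -- Outputs of the first dfs call have b at depth t, those of the rest of
    -- the scan an item c < b there.
    scan-unique : ∀ t a f mb rest X → Below X mb → Unique (out (scan t a f mb (a ∷ rest)))
    scan-unique t a zero    _        rest X _ = []
    scan-unique t a (suc f) nothing  rest X _ = []
    scan-unique t a (suc f) (just b) rest X _ with lookup α b ≼? lookup α a
    ... | no _  = []
    ... | yes _ = UniqueP.++⁺ (dfs-unique t b (a ∷ rest)) (scan-unique t a f (ln b) rest b below-b) disjoint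
      where
        below-b : Below b (ln b)
        below-b = nearest-below (ln-spec b)
        disjoint : ∀ {v} → ¬ (v ∈ out (dfs t b (b ∷ a ∷ rest)) × v ∈ out (scan t a f (ln b) (a ∷ rest)))
        disjoint {v} (m₁ , m₂) with dfs-sound t b (a ∷ rest) v m₁ | scan-sound t a f (ln b) rest b v below-b m₂
        ... | p , (len , _) , e₁ | c , p′ , c<b , _ , (len′ , _) , e₂ =
          FP.<-irrefl (sym (++-∷-middle p p′ (trans len (sym len′)) (trans (sym e₁) e₂))) c<b

  tick-⊕-cost : ∀ B r₁ r₂ → 1 ≤ length (out r₁) → cost r₁ ≤ B * length (out r₁) →
                cost r₂ ≤ suc (suc B * length (out r₂)) →
                cost (tick (r₁ ⊕ r₂)) ≤ suc (suc B * length (out (tick (r₁ ⊕ r₂))))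
  tick-⊕-cost B r₁ r₂ h₀ h₁ h₂ rewrite LP.length-++ (out r₁) {out r₂} = combine-cost {B = B} h₀ h₁ h₂

  mutual
    dfs-cost : ∀ t a rest → level a ≡ suc t →
               cost (dfs t a (a ∷ rest)) ≤ (suc (length rest) + 4 * t) * length (out (dfs t a (a ∷ rest)))
    dfs-cost zero    a rest _  = ℕP.≤-reflexive (sym (trans (ℕP.*-identityʳ _) (ℕP.+-identityʳ _)))
    dfs-cost (suc t) a rest la =
      subst (λ k → cost (dfs (suc t) a (a ∷ rest)) ≤ k * N) (per-output (length rest) t)
        (absorb {K = suc (suc B)} 1≤N (s≤s (absorb {K = suc B} 1≤N (scan-cost t a w (un a) rest up-level))))
      where
        B = suc (suc (length rest)) + 4 * t
        N = length (out (dfs (suc t) a (a ∷ rest)))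
        1≤N : 1 ≤ N
        1≤N = dfs-nonempty (suc t) a rest la
        up-level : ∀ b → un a ≡ just b → level b ≡ suc t
        up-level b e = ℕP.suc-injective (trans (proj₂ (nearest-just (un-spec a) e)) la)
        per-output : ∀ r t → 3 + (suc (suc r) + 4 * t) ≡ suc r + 4 * suc t
        per-output = solve-∀

    scan-cost : ∀ t a f mb rest → (∀ b → mb ≡ just b → level b ≡ suc t) →
                cost (scan t a f mb (a ∷ rest))
                  ≤ suc (suc (suc (suc (length rest)) + 4 * t) * length (out (scan t a f mb (a ∷ rest))))
    scan-cost t a zero    _        rest _   = z≤n
    scan-cost t a (suc f) nothing  rest _   = s≤s z≤n
    scan-cost t a (suc f) (just b) rest lev with lookup α b ≼? lookup α a
    ... | no _  = s≤s z≤n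
    ... | yes _ = tick-⊕-cost (suc (suc (length rest)) + 4 * t) (dfs t b (b ∷ a ∷ rest)) (scan t a f (ln b) (a ∷ rest))
                    (dfs-nonempty t b (a ∷ rest) lb) (dfs-cost t b (a ∷ rest) lb)
                    (scan-cost t a f (ln b) rest (λ b′ e → trans (proj₂ (nearest-just (ln-spec b) e)) lb))
      where
        lb : level b ≡ suc t
        lb = lev b refl

  T : ℕ
  T = m ∸ 1

  starts-sound : ∀ as s → s ∈ out (starts as) → ∃ λ a → a ∈ as × DfsOut T a [] s
  starts-sound (a ∷ as) s m with ∈-++⁻ (out (dfs T a (a ∷ []))) m
  ... | inj₁ m₁ = a , here refl , dfs-sound T a [] s m₁
  ... | inj₂ m₂ with starts-sound as s m₂
  ...   | a′ , a′∈as , out-a′ = a′ , there a′∈as , out-a′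

  starts-complete : ∀ as a p → a ∈ as → level a ≡ suc T → Chain T a p → p ∷ʳ a ∈ out (starts as)
  starts-complete (a ∷ as)  .a p (here refl) la ch = ∈-++⁺ˡ (dfs-complete T a [] p la ch)
  starts-complete (a′ ∷ as) a  p (there a∈as) la ch =
    ∈-++⁺ʳ (out (dfs T a′ (a′ ∷ []))) (starts-complete as a p a∈as la ch)

  -- Outputs of different starting items differ in their last item.
  starts-unique : ∀ as → AllPairs F._<_ as → Unique (out (starts as))
  starts-unique []       _             = []
  starts-unique (a ∷ as) (a<as ∷ sorted) =
    UniqueP.++⁺ (dfs-unique T a []) (starts-unique as sorted) disjoint
    where
      disjoint : ∀ {v} → ¬ (v ∈ out (dfs T a (a ∷ [])) × v ∈ out (starts as))
      disjoint {v} (m₁ , m₂) with dfs-sound T a [] v m₁ | starts-sound as v m₂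
      ... | p , (len , _) , e₁ | a′ , a′∈as , p′ , (len′ , _) , e₂ =
        FP.<-irrefl (++-∷-middle p p′ (trans len (sym len′)) (trans (sym e₁) e₂)) (All.lookup a<as a′∈as)

  starts-cost : ∀ as → (∀ a → a ∈ as → level a ≡ suc T) →
                cost (starts as) ≤ suc (suc (suc (4 * T)) * length (out (starts as)))
  starts-cost []       _   = s≤s z≤n
  starts-cost (a ∷ as) lev =
    tick-⊕-cost (suc (4 * T)) (dfs T a (a ∷ [])) (starts as) (dfs-nonempty T a [] (lev a (here refl)))
      (dfs-cost T a [] (lev a (here refl))) (starts-cost as (λ a′ a′∈as → lev a′ (there a′∈as)))

  output-unique : Unique output
  output-unique = starts-unique (horiz m) (Linked⇒AllPairs FP.<-trans (horiz-sorted m))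

  -- For a nonempty sequence, m ≥ 1 and the LISs are the chains ending in 𝕃^m.
  module Nonempty (i₀ : Fin w) where

    -- The item i₀ has RL ≥ 1, so m ≥ 1.
    m≡1+T : m ≡ suc T
    m≡1+T = suc-∸1 (ℕP.≤-trans (level-positive i₀) (m-max i₀))

    longest-exists : ∃ λ s → Inc s × length s ≡ m
    longest-exists with m-nonempty m (subst (1 ≤_) (sym m≡1+T) (s≤s z≤n)) ℕP.≤-refl
    ... | i , li with chain-exists (trans li m≡1+T)
    ...   | p , len , inc = p ∷ʳ i , inc , trans (length-∷ʳ p i) (trans (cong suc len) (sym m≡1+T))

    isLIS⇔ : ∀ s → IsLIS α s ⇔ (Inc s × length s ≡ m)
    isLIS⇔ s = mk⇔
      (λ (inc , longest) → inc , ℕP.≤-antisym (increasing≤m s inc)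
                                   (subst (_≤ length s) len₀ (longest s₀ inc₀)))
      (λ (inc , len) → inc , λ s′ inc′ → subst (length s′ ≤_) (sym len) (increasing≤m s′ inc′))
      where
        s₀ = proj₁ longest-exists
        inc₀ = proj₁ (proj₂ longest-exists)
        len₀ = proj₂ (proj₂ longest-exists)

    horiz-level : ∀ a → a ∈ horiz m → level a ≡ suc T
    horiz-level a a∈ = trans (Equivalence.to (horiz-mem m a) a∈) m≡1+T

    output-sound : ∀ s → s ∈ output → IsLIS α s
    output-sound s s∈ with starts-sound (horiz m) s s∈
    ... | a , _ , p , (len , inc) , refl = Equivalence.from (isLIS⇔ (p ∷ʳ a))
      (inc , trans (length-∷ʳ p a) (trans (cong suc len) (sym m≡1+T)))

    output-complete : ∀ s → IsLIS α s → s ∈ output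
    output-complete s lis with Equivalence.to (isLIS⇔ s) lis | initLast s
    ... | _   , len | []      = ⊥-elim (ℕP.<⇒≢ (subst (1 ≤_) (sym m≡1+T) (s≤s z≤n)) len)
    ... | inc , len | p ∷ʳ′ a =
      starts-complete (horiz m) a p (Equivalence.from (horiz-mem m a) la) (trans la m≡1+T) (|p| , inc)
      where
        1+|p| : suc (length p) ≡ m
        1+|p| = trans (sym (length-∷ʳ p a)) len
        la : level a ≡ m
        la = ℕP.≤-antisym (m-max a) (subst (_≤ level a) 1+|p| (length≤level p inc))
        |p| : length p ≡ T
        |p| = ℕP.suc-injective (trans 1+|p| m≡1+T)

    output-exact : ∀ s → s ∈ output ⇔ IsLIS α s
    output-exact s = mk⇔ (output-sound s) (output-complete s)

    -- Each of the N outputs has length m = T + 1 and costs at most 4 (T + 1).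
    steps-bound : ∀ (L : List (List (Fin w))) → Unique L → (∀ s → s ∈ L ⇔ IsLIS α s) →
                  steps ≤ 4 * sum (map length L)
    steps-bound L uniqueL L-exact = begin
        steps                    ≤⟨ absorb {K = 2 + 4 * T} 1≤N (starts-cost (horiz m) horiz-level) ⟩
        (3 + 4 * T) * N          ≤⟨ ℕP.*-monoˡ-≤ N (subst (3 + 4 * T ≤_) (sym (four-suc T)) (ℕP.n≤1+n _)) ⟩
        4 * suc T * N            ≤⟨ ℕP.*-monoʳ-≤ (4 * suc T) N≤|L| ⟩
        4 * suc T * length L     ≡⟨ reassociate T (length L) ⟩
        4 * (length L * suc T)   ≡⟨ cong (4 *_) (sym (sum-length-const L (suc T) all-length)) ⟩
        4 * sum (map length L)   ∎
      where
        open ℕP.≤-Reasoning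
        N = length output
        1≤N : 1 ≤ N
        1≤N = ∈⇒nonempty (output-complete (proj₁ longest-exists)
                            (Equivalence.from (isLIS⇔ _) (proj₂ longest-exists)))
        N≤|L| : N ≤ length L
        N≤|L| = unique-⊆-length output-unique
                  (λ {s} s∈ → Equivalence.from (L-exact s) (output-sound s s∈))
        all-length : ∀ s → s ∈ L → length s ≡ suc T
        all-length s s∈ = trans (proj₂ (Equivalence.to (isLIS⇔ s) (Equivalence.to (L-exact s) s∈))) m≡1+T
        four-suc : ∀ t → 4 * suc t ≡ suc (3 + 4 * t)
        four-suc = solve-∀
        reassociate : ∀ t l → 4 * suc t * l ≡ 4 * (l * suc t)
        reassociate = solve-∀

theorem3 : Σ ℕ λ c → (O : DecTotalOrder 0ℓ 0ℓ 0ℓ) → ∀ {n} (α : Vec (DecTotalOrder.Carrier O) (suc n))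
             (q : LIS.QNList O (suc n)) → LIS.IsQNList O α q →
             let open LIS.Algorithm O α q in
             Unique output
             × (∀ s → s ∈ output ⇔ LIS.IsLIS O α s)
             × (∀ (L : List (List (Fin (suc n)))) → Unique L → (∀ s → s ∈ L ⇔ LIS.IsLIS O α s) →
                  steps ≤ c * sum (map length L))
theorem3 = 4 , λ O α q isQN →
  let open Correctness O α q isQN
      open Nonempty F.zero
  in output-unique , output-exact , steps-bound
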